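{- Let $G=(V,E)$ be a connected finite undirected graph and $p$ an integer with $2\le p\le|V|$. If $G$ is not universally solvable for $p$ robots, then $|E|<p\cdot|V|$.
   Context: Robots are $R=[p]$; a configuration is an injective map $S:R\to V$. A pair $(S,S')$ of configurations is a valid move if it is one of: (i) a simple path move: there is a simple path $(u_0,\dots,u_k)$ in $G$ with $u_k\notin S(R)$, $u_0\notin S'(R)$, $S'(i)=S(i)$ for robots not on the path, and $S'(i)=u_{j+1}$ whenever $S(i)=u_j$, $0\le j\le k-1$; (ii) a simple rotation move: there is a simple cycle $(u_0,\dots,u_{k-1},u_k=u_0)$ in $G$ all of whose vertices are occupied in $S$ and in $S'$, robots off the cycle stay fixed, and $S'(i)=u_{j+1}$ whenever $S(i)=u_j$; (iii) a dummy move $(S,S)$. $T$ is reachable from $S$ if there is a finite sequence $S=S_0,\dots,S_t=T$ with each $(S_{k-1},S_k)$ a valid move. $G$ is universally solvable for $p$ robots if every configuration is reachable from every other. -}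

module Defs where

open import Data.Nat using (ℕ; zero; suc; _+_; _≤_)
open import Data.Bool using (Bool; true; false; if_then_else_; _∧_)
open import Data.Fin using (Fin; zero; suc; inject₁; fromℕ; toℕ; _<_)
open import Data.Fin.Properties using (_<?_)
open import Data.List using (List; map; allFin)
open import Data.Nat.ListAction using (sum)
open import Data.Product using (Σ; ∃; ∃-syntax; _×_; _,_)
open import Relation.Nullary using (¬_; does)
open import Relation.Binary.PropositionalEquality using (_≡_; _≢_)
open import Relation.Binary.Construct.Closure.ReflexiveTransitive using (Star)
open import Function.Definitions using (Injective)

record Graph (n : ℕ) : Set where
  field
    adj   : Fin n → Fin n → Bool
    sym   : ∀ u v → adj u v ≡ adj v u
    irrefl : ∀ u → adj u u ≡ false

open Graph public

_∼[_]_ : ∀ {n} → Fin n → Graph n → Fin n → Set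
u ∼[ G ] v = adj G u v ≡ true

data Walk {n} (G : Graph n) : Fin n → Fin n → Set where
  [] : ∀ {u} → Walk G u u
  _∷_ : ∀ {u v w} → u ∼[ G ] v → Walk G v w → Walk G u w

Connected : ∀ {n} → Graph n → Set
Connected G = ∀ u v → Walk G u v

edgeCount : ∀ {n} → Graph n → ℕ
edgeCount {n} G =
  sum (map (λ u → sum (map (λ v → if does (u <? v) ∧ adj G u v then 1 else 0)
                          (allFin n)))
           (allFin n))

record Config (n p : ℕ) : Set where
  constructor config
  field
    pos : Fin p → Fin n
    inj : Injective _≡_ _≡_ pos

open Config public

Occupied : ∀ {n p} → Config n p → Fin n → Set
Occupied {p = p} S x = ∃[ i ] pos S i ≡ x

-- a simple path (u_0 , … , u_k) with k+1 vertices
record SimplePath {n} (G : Graph n) (k : ℕ) : Set where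
  field
    vtx   : Fin (suc k) → Fin n
    dist  : Injective _≡_ _≡_ vtx
    edges : ∀ (j : Fin k) → vtx (inject₁ j) ∼[ G ] vtx (suc j)

open SimplePath public

-- cyclic successor on Fin (suc k)
next : ∀ {k} → Fin (suc k) → Fin (suc k)
next {zero} zero = zero
next {suc k} zero = suc zero
next {suc k} (suc j) with next {k} j
... | zero = zero
... | suc j' = suc (suc j')

-- a simple cycle (u_0 , … , u_k , u_{k+1} = u_0) with k+1 ≥ 3 distinct vertices
record SimpleCycle {n} (G : Graph n) (k : ℕ) : Set where
  field
    len   : 2 ≤ k
    cvtx  : Fin (suc k) → Fin n
    cdist : Injective _≡_ _≡_ cvtx
    cedges : ∀ (j : Fin (suc k)) → cvtx j ∼[ G ] cvtx (next j)

open SimpleCycle public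

PathMove : ∀ {n p} (G : Graph n) → Config n p → Config n p → Set
PathMove {n} {p} G S S' =
  ∃[ k ] Σ (SimplePath G k) λ P →
      (¬ Occupied S (vtx P (fromℕ k)))
    × (¬ Occupied S' (vtx P zero))
    × (∀ i → (∀ j → pos S i ≢ vtx P j) → pos S' i ≡ pos S i)
    × (∀ i (j : Fin k) → pos S i ≡ vtx P (inject₁ j) → pos S' i ≡ vtx P (suc j))

RotationMove : ∀ {n p} (G : Graph n) → Config n p → Config n p → Set
RotationMove {n} {p} G S S' =
  ∃[ k ] Σ (SimpleCycle G k) λ C →
      (∀ j → Occupied S (cvtx C j))
    × (∀ j → Occupied S' (cvtx C j))
    × (∀ i → (∀ j → pos S i ≢ cvtx C j) → pos S' i ≡ pos S i)
    × (∀ i j → pos S i ≡ cvtx C j → pos S' i ≡ cvtx C (next j))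

DummyMove : ∀ {n p} → Config n p → Config n p → Set
DummyMove S S' = ∀ i → pos S' i ≡ pos S i

data ValidMove {n p} (G : Graph n) (S S' : Config n p) : Set where
  path     : PathMove G S S' → ValidMove G S S'
  rotation : RotationMove G S S' → ValidMove G S S'
  dummy    : DummyMove S S' → ValidMove G S S'

Reachable : ∀ {n p} → Graph n → Config n p → Config n p → Set
Reachable G = Star (ValidMove G)

UniversallySolvable : ∀ {n} → Graph n → ℕ → Set
UniversallySolvable {n} G p = ∀ (S T : Config n p) → Reachable G S T

-- We prove the contrapositive. |E| is the sum over u of the number of neighbours v > u, and
-- the last vertex contributes nothing, so |E| ≥ p·|V| yields a vertex c with p + 1 neighbours.
-- Such a star already makes G universally solvable with single-robot steps. These are
-- reversible, so it suffices to reach one canonical configuration from every configuration: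
-- first gather all robots into the star, then, with the center empty, sort them on the leaves,
-- using the center and a free leaf (there are p + 1 leaves for p robots) as buffers.

module Submission where

open import Defs hiding (sym)
open import Data.Nat using (ℕ; zero; suc; _+_; _*_; _≤_; _<_; _≤?_; z≤n; s≤s)
open import Data.Nat.Properties using (module ≤-Reasoning; <⇒≱; ≮⇒≥; ≤-trans; n<1+n; ≤-refl; ≤-pred; <-≤-trans; +-mono-≤; +-mono-<-≤; +-mono-≤-<; *-suc; *-zeroʳ)
open import Data.Nat.ListAction using (sum)
open import Data.Bool using (Bool; true; false; if_then_else_; _∧_)
open import Data.Bool.Properties using (∧-conicalʳ)
open import Data.Fin using (Fin; zero; suc; inject₁; fromℕ; lift; _≟_; _<?_)
open import Data.Fin.Properties using (≤fromℕ; lift-injective; suc-injective; inject₁-injective; any?; pigeonhole; <⇒≢)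
open import Data.List using (List; []; _∷_; map; tabulate; allFin)
open import Data.List.Properties using (map-tabulate; tabulate-cong)
open import Data.List.Membership.Propositional using (_∈_)
open import Data.List.Relation.Unary.Any using (here; there)
open import Data.Product using (Σ; ∃-syntax; _×_; _,_; proj₁; proj₂)
open import Data.Unit using (⊤; tt)
open import Data.Sum using (_⊎_; inj₁; inj₂; map₂)
open import Data.Vec.Functional using (updateAt)
open import Data.Vec.Functional.Properties using (updateAt-updates; updateAt-minimal)
open import Function using (id; _∘_; const)
open import Function.Definitions using (Injective)
open import Relation.Binary.PropositionalEquality using (_≡_; _≢_; refl; sym; trans; cong; subst)
open import Relation.Binary.Construct.Closure.ReflexiveTransitive using (Star; ε; _◅_; _◅◅_; gmap; reverse)
open import Relation.Nullary using (¬_; Dec; yes; no; does; contradiction)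
open import Relation.Nullary.Decidable using (dec-false; _⊎-dec_; ¬?; decidable-stable)
open import Relation.Unary using (Decidable)

∑ : ∀ {m} → (Fin m → ℕ) → ℕ
∑ f = sum (tabulate f)

∑-cong : ∀ {m} {f g : Fin m → ℕ} → (∀ i → f i ≡ g i) → ∑ f ≡ ∑ g
∑-cong f≗g = cong sum (tabulate-cong f≗g)

sum-map-allFin : ∀ {m} (f : Fin m → ℕ) → sum (map f (allFin m)) ≡ ∑ f
sum-map-allFin f = cong sum (map-tabulate id f)

∑-const : ∀ m c → ∑ {m} (const c) ≡ c * m
∑-const zero    c = sym (*-zeroʳ c)
∑-const (suc m) c = trans (cong (c +_) (∑-const m c)) (sym (*-suc c m))

∑-mono-≤ : ∀ {m} {f g : Fin m → ℕ} → (∀ i → f i ≤ g i) → ∑ f ≤ ∑ g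
∑-mono-≤ {zero}  f≤g = z≤n
∑-mono-≤ {suc m} f≤g = +-mono-≤ (f≤g zero) (∑-mono-≤ (f≤g ∘ suc))

∑-mono-< : ∀ {m} {f g : Fin m → ℕ} → (∀ i → f i ≤ g i) → ∀ i → f i < g i → ∑ f < ∑ g
∑-mono-< f≤g zero    fi<gi = +-mono-<-≤ fi<gi (∑-mono-≤ (f≤g ∘ suc))
∑-mono-< f≤g (suc i) fi<gi = +-mono-≤-< (f≤g zero) (∑-mono-< (f≤g ∘ suc) i fi<gi)

isNo : ∀ {P : Set} → Dec P → ℕ
isNo (yes _) = 0
isNo (no  _) = 1

isNo-antitone : ∀ {P Q : Set} (P? : Dec P) (Q? : Dec Q) → (P → Q) → isNo Q? ≤ isNo P?
isNo-antitone (yes p) (no ¬q) P→Q = contradiction (P→Q p) ¬q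
isNo-antitone (yes _) (yes _) _   = z≤n
isNo-antitone (no  _) (yes _) _   = z≤n
isNo-antitone (no  _) (no  _) _   = s≤s z≤n

isNo-< : ∀ {P Q : Set} (P? : Dec P) (Q? : Dec Q) → ¬ P → Q → isNo Q? < isNo P?
isNo-< (yes p) _       ¬p _ = contradiction p ¬p
isNo-< (no  _) (no ¬q) _  q = contradiction q ¬q
isNo-< (no  _) (yes _) _  _ = s≤s z≤n

count : ∀ {m} → (Fin m → Bool) → ℕ
count P = ∑ (λ x → if P x then 1 else 0)

count⇒injection : ∀ {m k} (P : Fin m → Bool) → k ≤ count P →
                  Σ (Fin k → Fin m) λ ι → Injective _≡_ _≡_ ι × (∀ j → P (ι j) ≡ true)
count⇒injection {zero}          P z≤n = (λ ()) , (λ {}) , (λ ())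
count⇒injection {suc m} {k}     P k≤count with P zero in P0
count⇒injection {suc m} {k}     P k≤count       | false
  with ι , ι-inj , Pι ← count⇒injection (P ∘ suc) k≤count =
  suc ∘ ι , ι-inj ∘ suc-injective , Pι
count⇒injection {suc m} {zero}  P _             | true = (λ ()) , (λ {}) , (λ ())
count⇒injection {suc m} {suc k} P (s≤s k≤count) | true
  with ι , ι-inj , Pι ← count⇒injection (P ∘ suc) k≤count =
  lift 1 ι , lift-injective ι ι-inj 1 , λ { zero → P0 ; (suc j) → Pι j }

higherDegree : ∀ {n} → Graph n → Fin n → ℕ
higherDegree G u = count (λ v → does (u <? v) ∧ adj G u v)

edgeCount≡∑higherDegree : ∀ {n} (G : Graph n) → edgeCount G ≡ ∑ (higherDegree G)
edgeCount≡∑higherDegree {n} G =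
  trans (sum-map-allFin λ u → sum (map (edge u) (allFin n))) (∑-cong λ u → sum-map-allFin (edge u))
  where
  edge : Fin n → Fin n → ℕ
  edge u v = if does (u <? v) ∧ adj G u v then 1 else 0

higherDegree-fromℕ : ∀ {m} (G : Graph (suc m)) → higherDegree G (fromℕ m) ≡ 0
higherDegree-fromℕ {m} G = trans (∑-cong term≡0) (∑-const (suc m) 0)
  where
  term≡0 : ∀ v → (if does (fromℕ m <? v) ∧ adj G (fromℕ m) v then 1 else 0) ≡ 0
  term≡0 v rewrite dec-false (fromℕ m <? v) (λ m<v → <⇒≱ m<v (≤fromℕ v)) = refl

edgeCount<-bound : ∀ {m} (G : Graph (suc m)) {d} → 0 < d → (∀ u → higherDegree G u ≤ d) →
                   edgeCount G < d * suc m
edgeCount<-bound {m} G {d} 0<d deg≤d = begin-strict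
  edgeCount G              ≡⟨ edgeCount≡∑higherDegree G ⟩
  ∑ (higherDegree G)       <⟨ ∑-mono-< deg≤d (fromℕ m) last<d ⟩
  ∑ {suc m} (const d)      ≡⟨ ∑-const (suc m) d ⟩
  d * suc m                ∎
  where
  open ≤-Reasoning
  last<d : higherDegree G (fromℕ m) < d
  last<d = subst (_< d) (sym (higherDegree-fromℕ G)) 0<d

module Walks {n : ℕ} (G : Graph n) where

  ∼⇒≢ : ∀ {u v} → u ∼[ G ] v → u ≢ v
  ∼⇒≢ {u} u∼u refl with () ← trans (sym u∼u) (irrefl G u)

  ∼-sym : ∀ {u v} → u ∼[ G ] v → v ∼[ G ] u
  ∼-sym {u} {v} u∼v = trans (Graph.sym G v u) u∼v

  vertices : ∀ {x y} → Walk G x y → List (Fin n)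
  vertices {x} []      = x ∷ []
  vertices {x} (_ ∷ w) = x ∷ vertices w

  start∈vertices : ∀ {x y} (w : Walk G x y) → x ∈ vertices w
  start∈vertices []      = here refl
  start∈vertices (_ ∷ w) = here refl

  firstHit : ∀ {A : Fin n → Set} → Decidable A → ∀ {x y} → Walk G x y → A y →
             ∃[ z ] A z × Σ (Walk G x z) λ w → ∀ v → v ∈ vertices w → A v → v ≡ z
  firstHit A? {x} [] y∈A = x , y∈A , [] , λ { v (here v≡x) _ → v≡x }
  firstHit A? {x} (x∼u ∷ w) y∈A with A? x
  ... | yes x∈A = x , x∈A , [] , λ { v (here v≡x) _ → v≡x }
  ... | no  x∉A with z , z∈A , w′ , only-z ← firstHit A? w y∈A =
    z , z∈A , x∼u ∷ w′ , λ { v (here refl) v∈A → contradiction v∈A x∉A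
                           ; v (there v∈w′) v∈A → only-z v v∈w′ v∈A }

module Robots {n : ℕ} (G : Graph n) {p : ℕ} where

  open Walks G

  Configuration : Set
  Configuration = Config n p

  occupied? : (S : Configuration) (x : Fin n) → Dec (Occupied S x)
  occupied? S x = any? (λ i → pos S i ≟ x)

  record Moved (S : Configuration) (i : Fin p) (b : Fin n) (T : Configuration) : Set where
    constructor moved
    field
      arrived : pos T i ≡ b
      fixed   : ∀ j → j ≢ i → pos T j ≡ pos S j

  moved-trans : ∀ {S U T i a b} → Moved S i a U → Moved U i b T → Moved S i b T
  moved-trans (moved _ fixed₁) (moved arrived fixed₂) =
    moved arrived λ j j≢i → trans (fixed₂ j j≢i) (fixed₁ j j≢i)

  moved-vacates : ∀ {S T i b} → pos S i ≢ b → Moved S i b T → ¬ Occupied T (pos S i)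
  moved-vacates {S} {i = i} a≢b (moved arrived fixed) (j , Tj≡a) with j ≟ i
  ... | yes refl = a≢b (trans (sym Tj≡a) arrived)
  ... | no  j≢i  = j≢i (inj S (trans (sym (fixed j j≢i)) Tj≡a))

  moved-injective : ∀ {S i b} {f : Fin p → Fin n} → ¬ Occupied S b →
                    f i ≡ b → (∀ j → j ≢ i → f j ≡ pos S j) → Injective _≡_ _≡_ f
  moved-injective {S} {i} b-free fi≡b fixed {x} {y} fx≡fy with x ≟ i | y ≟ i
  ... | yes refl | yes refl = refl
  ... | yes refl | no  y≢i  =
    contradiction (y , trans (sym (fixed y y≢i)) (trans (sym fx≡fy) fi≡b)) b-free
  ... | no  x≢i  | yes refl =
    contradiction (x , trans (sym (fixed x x≢i)) (trans fx≡fy fi≡b)) b-free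
  ... | no  x≢i  | no  y≢i  = inj S (trans (sym (fixed x x≢i)) (trans fx≡fy (fixed y y≢i)))

  data Step (S T : Configuration) : Set where
    step : ∀ {i b} → pos S i ∼[ G ] b → ¬ Occupied S b → Moved S i b T → Step S T

  step-sym : ∀ {S T} → Step S T → Step T S
  step-sym {S} (step a∼b _ m@(moved arrived fixed)) =
    step (subst (_∼[ G ] pos S _) (sym arrived) (∼-sym a∼b)) (moved-vacates (∼⇒≢ a∼b) m)
         (moved refl λ j j≢i → sym (fixed j j≢i))

  step⇒pathMove : ∀ {S T} → Step S T → PathMove G S T
  step⇒pathMove {S} {T} (step {i} {b} a∼b b-free m@(moved arrived fixed)) =
    1 , edge , b-free , moved-vacates (∼⇒≢ a∼b) m , off-edge , along-edge
    where
    ends : Fin 2 → Fin n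
    ends zero       = pos S i
    ends (suc zero) = b

    ends-injective : Injective _≡_ _≡_ ends
    ends-injective {zero}     {zero}     _ = refl
    ends-injective {zero}     {suc zero} a≡b = contradiction a≡b (∼⇒≢ a∼b)
    ends-injective {suc zero} {zero}     b≡a = contradiction (sym b≡a) (∼⇒≢ a∼b)
    ends-injective {suc zero} {suc zero} _ = refl

    edge : SimplePath G 1
    edge = record { vtx = ends ; dist = ends-injective ; edges = λ { zero → a∼b } }

    off-edge : ∀ k → (∀ j → pos S k ≢ ends j) → pos T k ≡ pos S k
    off-edge k off with k ≟ i
    ... | yes refl = contradiction refl (off zero)
    ... | no  k≢i  = fixed k k≢i

    along-edge : ∀ k (j : Fin 1) → pos S k ≡ ends (inject₁ j) → pos T k ≡ ends (suc j)
    along-edge k zero Sk≡a with refl ← inj S Sk≡a = arrived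

  Move : Configuration → Configuration → Set
  Move S T = Step S T ⊎ DummyMove S T

  Reach : Configuration → Configuration → Set
  Reach = Star Move

  reach-sym : ∀ {S T} → Reach S T → Reach T S
  reach-sym = reverse λ { (inj₁ st) → inj₁ (step-sym st) ; (inj₂ same) → inj₂ (sym ∘ same) }

  reach⇒reachable : ∀ {S T} → Reach S T → Reachable G S T
  reach⇒reachable = gmap id λ { (inj₁ st) → path (step⇒pathMove st) ; (inj₂ same) → dummy same }

  CanMove : Configuration → Fin p → Fin n → Set
  CanMove S i b = ∃[ T ] Reach S T × Moved S i b T

  stepTo : ∀ S i {b} → pos S i ∼[ G ] b → ¬ Occupied S b → CanMove S i b
  stepTo S i {b} a∼b b-free = T , inj₁ (step a∼b b-free i↦b) ◅ ε , i↦b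
    where
    f : Fin p → Fin n
    f = updateAt (pos S) i (const b)

    fixed : ∀ j → j ≢ i → f j ≡ pos S j
    fixed j j≢i = updateAt-minimal j i (pos S) j≢i

    T : Configuration
    T = config f (moved-injective {S} b-free (updateAt-updates i (pos S)) fixed)

    i↦b : Moved S i b T
    i↦b = moved (updateAt-updates i (pos S)) fixed

  Alone : Configuration → Fin p → List (Fin n) → Set
  Alone S i xs = ∀ j → pos S j ∈ xs → j ≡ i

  moved-alone : ∀ {S U i b xs} → Moved S i b U → Alone S i xs → Alone U i xs
  moved-alone {i = i} (moved _ fixed) alone j Uj∈xs with j ≟ i
  ... | yes j≡i = j≡i
  ... | no  j≢i = alone j (subst (_∈ _) (fixed j j≢i) Uj∈xs)

  alone⇒free : ∀ {S i xs v} → Alone S i xs → v ∈ xs → pos S i ≢ v → ¬ Occupied S v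
  alone⇒free alone v∈xs Si≢v (j , Sj≡v) with refl ← alone j (subst (_∈ _) (sym Sj≡v) v∈xs) =
    Si≢v Sj≡v

  alone-tail : ∀ {S i x xs} → Alone S i (x ∷ xs) → Alone S i xs
  alone-tail alone j = alone j ∘ there

  moveAlong : ∀ {x y} (w : Walk G x y) S i → pos S i ≡ x → Alone S i (vertices w) → CanMove S i y
  moveAlong [] S i refl _ = S , ε , moved refl λ _ _ → refl
  moveAlong (x∼u ∷ w) S i refl alone
    with U , S⇝U , movedU ← stepTo S i x∼u (alone⇒free {S} (alone-tail {S} alone) (start∈vertices w) (∼⇒≢ x∼u))
    with T , U⇝T , movedT ← moveAlong w U i (Moved.arrived movedU) (moved-alone movedU (alone-tail {S} alone)) =
    T , S⇝U ◅◅ U⇝T , moved-trans movedU movedT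

  pullAlong : ∀ {x y} (w : Walk G x y) S → ¬ Occupied S y →
              (∀ v → v ∈ vertices w → ¬ Occupied S v) ⊎ (∃[ i ] pos S i ∈ vertices w × CanMove S i y)
  pullAlong [] S y-free = inj₁ λ { v (here refl) → y-free }
  pullAlong {x} (x∼u ∷ w) S y-free with pullAlong w S y-free
  ... | inj₂ (i , Si∈w , i↦y) = inj₂ (i , there Si∈w , i↦y)
  ... | inj₁ w-free with occupied? S x
  ...   | no  x-free = inj₁ λ { v (here refl) → x-free ; v (there v∈w) → w-free v v∈w }
  ...   | yes (i , Si≡x) = inj₂ (i , here Si≡x , moveAlong (x∼u ∷ w) S i Si≡x alone)
    where
    alone : Alone S i (vertices (x∼u ∷ w))
    alone j (here Sj≡x)  = inj S (trans Sj≡x (sym Si≡x))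
    alone j (there Sj∈w) = contradiction (j , refl) (w-free _ Sj∈w)

  record MovesWithin (A : Fin n → Set) (S T : Configuration) : Set where
    constructor moves-within
    field
      stays-or-within : ∀ j → pos T j ≡ pos S j ⊎ (A (pos S j) × A (pos T j))

  within-outside : ∀ {A S T j} → MovesWithin A S T → ¬ A (pos S j) → pos T j ≡ pos S j
  within-outside {j = j} (moves-within within) Sj∉A with within j
  ... | inj₁ Tj≡Sj       = Tj≡Sj
  ... | inj₂ (Sj∈A , _) = contradiction Sj∈A Sj∉A

  within-inside : ∀ {A S T j} → MovesWithin A S T → A (pos S j) → A (pos T j)
  within-inside {A} {j = j} (moves-within within) Sj∈A with within j
  ... | inj₁ Tj≡Sj       = subst A (sym Tj≡Sj) Sj∈A
  ... | inj₂ (_ , Tj∈A) = Tj∈A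

  within-trans : ∀ {A S U T} → MovesWithin A S U → MovesWithin A U T → MovesWithin A S T
  within-trans {A} (moves-within S→U) (moves-within U→T) = moves-within λ j → compose (S→U j) (U→T j)
    where
    compose : ∀ {s u t} → u ≡ s ⊎ (A s × A u) → t ≡ u ⊎ (A u × A t) → t ≡ s ⊎ (A s × A t)
    compose (inj₁ u≡s)       (inj₁ t≡u)       = inj₁ (trans t≡u u≡s)
    compose (inj₁ u≡s)       (inj₂ (u∈A , t∈A)) = inj₂ (subst A u≡s u∈A , t∈A)
    compose (inj₂ (s∈A , u∈A)) (inj₁ t≡u)       = inj₂ (s∈A , subst A (sym t≡u) u∈A)
    compose (inj₂ (s∈A , _))   (inj₂ (_ , t∈A))   = inj₂ (s∈A , t∈A)

  Improves : (Configuration → Fin p → Set) → Configuration → Configuration → Set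
  Improves Good S T = (∀ j → Good S j → Good T j) × ∃[ i ] ¬ Good S i × Good T i

  module _ {Good : Configuration → Fin p → Set} (good? : ∀ S j → Dec (Good S j)) where

    badCount : Configuration → ℕ
    badCount S = ∑ λ j → isNo (good? S j)

    improves⇒badCount< : ∀ {S T} → Improves Good S T → badCount T < badCount S
    improves⇒badCount< {S} {T} (stays-good , i , bad , good) =
      ∑-mono-< (λ j → isNo-antitone (good? S j) (good? T j) (stays-good j)) i
               (isNo-< (good? S i) (good? T i) bad good)

    reachAllGood : (Inv : Configuration → Set) →
                   (∀ S → Inv S → ∀ r → ¬ Good S r → ∃[ T ] Reach S T × Inv T × Improves Good S T) →
                   ∀ S → Inv S → ∃[ T ] Reach S T × Inv T × (∀ j → Good T j)
    reachAllGood Inv improve S inv = go (suc (badCount S)) S ≤-refl inv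
      where
      go : ∀ fuel S → badCount S < fuel → Inv S → ∃[ T ] Reach S T × Inv T × (∀ j → Good T j)
      go zero       _ ()    _
      go (suc fuel) S bound inv with any? (λ j → ¬? (good? S j))
      ... | no  none-bad = S , ε , inv , λ j → decidable-stable (good? S j) (none-bad ∘ (j ,_))
      ... | yes (r , bad)
        with T , S⇝T , invT , better ← improve S inv r bad
        with U , T⇝U , invU , all-good ←
               go fuel T (<-≤-trans (improves⇒badCount< better) (≤-pred bound)) invT =
        U , S⇝T ◅◅ T⇝U , invU , all-good

  Inside : (Fin n → Set) → Configuration → Fin p → Set
  Inside A S j = A (pos S j)

  entering-improves : ∀ {A S U T i z} → MovesWithin A S U → Moved U i z T → A z → ¬ A (pos U i) →
                      Improves (Inside A) S T
  entering-improves {A} {S} {U} {T} {i} within (moved arrived fixed) z∈A Ui∉A =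
    stays-inside , i , Ui∉A ∘ within-inside within , subst A (sym arrived) z∈A
    where
    stays-inside : ∀ j → A (pos S j) → A (pos T j)
    stays-inside j Sj∈A with j ≟ i
    ... | yes refl = subst A (sym arrived) z∈A
    ... | no  j≢i  = subst A (sym (fixed j j≢i)) (within-inside within Sj∈A)

  -- A robot outside A is brought in by emptying the first vertex of A on a walk from it
  -- to A and pulling the last robot on that walk into the hole.
  module Gathering (connected : Connected G) {A : Fin n → Set} (A? : Decidable A) {a : Fin n} (a∈A : A a)
                   (clear : ∀ S z → A z → ∃[ T ] Reach S T × ¬ Occupied T z × MovesWithin A S T) where

    enter : ∀ S → ⊤ → ∀ r → ¬ A (pos S r) → ∃[ T ] Reach S T × ⊤ × Improves (Inside A) S T
    enter S _ r Sr∉A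
      with z , z∈A , w , only-z ← firstHit A? (connected (pos S r) a) a∈A
      with U , S⇝U , z-free , within ← clear S z z∈A
      with pullAlong w U z-free
    ... | inj₁ w-free = contradiction (r , within-outside within Sr∉A) (w-free (pos S r) (start∈vertices w))
    ... | inj₂ (i , Ui∈w , T , U⇝T , i↦z) =
      T , S⇝U ◅◅ U⇝T , tt ,
      entering-improves within i↦z z∈A λ Ui∈A → z-free (i , only-z _ Ui∈w Ui∈A)

    gather : ∀ S → ∃[ T ] Reach S T × (∀ j → A (pos T j))
    gather S with T , S⇝T , _ , inside ← reachAllGood (λ S j → A? (pos S j)) (λ _ → ⊤) enter S tt =
      T , S⇝T , inside

module LargeStar {n : ℕ} (G : Graph n) {p : ℕ} (connected : Connected G) (c : Fin n)
            (leaf : Fin (suc p) → Fin n) (leaf-injective : Injective _≡_ _≡_ leaf)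
            (c∼leaf : ∀ e → c ∼[ G ] leaf e) where

  open Walks G
  open Robots G {p}

  IsLeaf : Fin n → Set
  IsLeaf v = ∃[ e ] leaf e ≡ v

  InStar : Fin n → Set
  InStar v = v ≡ c ⊎ IsLeaf v

  inStar? : Decidable InStar
  inStar? v = (v ≟ c) ⊎-dec any? (λ e → leaf e ≟ v)

  leaf∼c : ∀ {v} → IsLeaf v → v ∼[ G ] c
  leaf∼c (e , refl) = ∼-sym (c∼leaf e)

  leaf≢c : ∀ {v} → IsLeaf v → v ≢ c
  leaf≢c v-leaf = ∼⇒≢ (leaf∼c v-leaf)

  leaves-not-all-occupied : ∀ S → ¬ (∀ e → Occupied S (leaf e))
  leaves-not-all-occupied S occupant
    with e₁ , e₂ , e₁<e₂ , same ← pigeonhole (n<1+n p) (proj₁ ∘ occupant) =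
    <⇒≢ e₁<e₂ (leaf-injective (trans (sym (proj₂ (occupant e₁)))
                                     (trans (cong (pos S) same) (proj₂ (occupant e₂)))))

  freeLeaf : ∀ S → ∃[ e ] ¬ Occupied S (leaf e)
  freeLeaf S with any? (λ e → ¬? (occupied? S (leaf e)))
  ... | yes free     = free
  ... | no  none-free =
    contradiction (λ e → decidable-stable (occupied? S (leaf e)) (none-free ∘ (e ,_)))
                  (leaves-not-all-occupied S)

  record Vacated (x : Fin n) (S T : Configuration) : Set where
    constructor vacated
    field
      x-free         : ¬ Occupied T x
      stays-or-leaves : ∀ j → pos T j ≡ pos S j ⊎ (pos S j ≡ x × IsLeaf (pos T j))

  vacant⇒vacated : ∀ {S x} → ¬ Occupied S x → Vacated x S S
  vacant⇒vacated x-free = vacated x-free λ _ → inj₁ refl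

  moved⇒vacated : ∀ {S T k x b} → pos S k ≡ x → x ≢ b → IsLeaf b → Moved S k b T → Vacated x S T
  moved⇒vacated {S} {T} {k} refl x≢b b-leaf k↦b@(moved arrived fixed) =
    vacated (moved-vacates x≢b k↦b) stays-or-leaves
    where
    stays-or-leaves : ∀ j → pos T j ≡ pos S j ⊎ (pos S j ≡ pos S k × IsLeaf (pos T j))
    stays-or-leaves j with j ≟ k
    ... | yes refl = inj₂ (refl , subst IsLeaf (sym arrived) b-leaf)
    ... | no  j≢k  = inj₁ (fixed j j≢k)

  vacated⇒within : ∀ {S T x} → InStar x → Vacated x S T → MovesWithin InStar S T
  vacated⇒within x∈star (vacated _ stays-or-leaves) =
    moves-within λ j → map₂ (λ (Sj≡x , Tj-leaf) → subst InStar (sym Sj≡x) x∈star , inj₂ Tj-leaf)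
                                (stays-or-leaves j)

  hop : ∀ S k → pos S k ∼[ G ] c → ¬ Occupied S c → ∀ e → ¬ Occupied S (leaf e) → CanMove S k (leaf e)
  hop S k k∼c c-free e e-free = moveAlong (k∼c ∷ c∼leaf e ∷ []) S k refl alone
    where
    alone : Alone S k (pos S k ∷ c ∷ leaf e ∷ [])
    alone j (here Sj≡Sk)                = inj S Sj≡Sk
    alone j (there (here Sj≡c))         = contradiction (j , Sj≡c) c-free
    alone j (there (there (here Sj≡e))) = contradiction (j , Sj≡e) e-free

  vacateCenter : ∀ S → ∃[ T ] Reach S T × Vacated c S T
  vacateCenter S with occupied? S c
  ... | no  c-free       = S , ε , vacant⇒vacated c-free
  ... | yes (k , Sk≡c)
    with e , e-free ← freeLeaf S
    with T , S⇝T , k↦e ← stepTo S k (subst (_∼[ G ] leaf e) (sym Sk≡c) (c∼leaf e)) e-free =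
    T , S⇝T , moved⇒vacated Sk≡c (∼⇒≢ (c∼leaf e)) (e , refl) k↦e

  vacateLeaf : ∀ S {z} → IsLeaf z → ¬ Occupied S c → ∃[ T ] Reach S T × Vacated z S T
  vacateLeaf S {z} z-leaf c-free with occupied? S z
  ... | no  z-free       = S , ε , vacant⇒vacated z-free
  ... | yes (k , Sk≡z)
    with e , e-free ← freeLeaf S
    with T , S⇝T , k↦e ← hop S k (subst (_∼[ G ] c) (sym Sk≡z) (leaf∼c z-leaf)) c-free e e-free =
    T , S⇝T , moved⇒vacated Sk≡z (λ z≡e → e-free (k , trans Sk≡z z≡e)) (e , refl) k↦e

  clearStar : ∀ S z → InStar z → ∃[ T ] Reach S T × ¬ Occupied T z × MovesWithin InStar S T
  clearStar S z (inj₁ refl) with T , S⇝T , vac ← vacateCenter S =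
    T , S⇝T , Vacated.x-free vac , vacated⇒within (inj₁ refl) vac
  clearStar S z (inj₂ z-leaf)
    with U , S⇝U , vacU ← vacateCenter S
    with T , U⇝T , vacT ← vacateLeaf U z-leaf (Vacated.x-free vacU) =
    T , S⇝U ◅◅ U⇝T , Vacated.x-free vacT ,
    within-trans (vacated⇒within (inj₁ refl) vacU) (vacated⇒within (inj₂ z-leaf) vacT)

  OnLeaves : Configuration → Set
  OnLeaves S = ∀ j → IsLeaf (pos S j)

  onLeaves⇒c-free : ∀ {S} → OnLeaves S → ¬ Occupied S c
  onLeaves⇒c-free onLeaves (j , Sj≡c) = leaf≢c (onLeaves j) Sj≡c

  vacated-onLeaves : ∀ {x S T} → OnLeaves S → Vacated x S T → OnLeaves T
  vacated-onLeaves onLeaves (vacated _ stays-or-leaves) j with stays-or-leaves j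
  ... | inj₁ Tj≡Sj         = subst IsLeaf (sym Tj≡Sj) (onLeaves j)
  ... | inj₂ (_ , Tj-leaf) = Tj-leaf

  moved-onLeaves : ∀ {U T i b} → OnLeaves U → IsLeaf b → Moved U i b T → OnLeaves T
  moved-onLeaves {i = i} onLeaves b-leaf (moved arrived fixed) j with j ≟ i
  ... | yes refl = subst IsLeaf (sym arrived) b-leaf
  ... | no  j≢i  = subst IsLeaf (sym (fixed j j≢i)) (onLeaves j)

  gathered-onLeaves : ∀ {S T} → (∀ j → InStar (pos S j)) → Vacated c S T → OnLeaves T
  gathered-onLeaves inStar (vacated c-free stays-or-leaves) j with stays-or-leaves j | inStar j
  ... | inj₂ (_ , Tj-leaf) | _              = Tj-leaf
  ... | inj₁ Tj≡Sj         | inj₁ Sj≡c      = contradiction (j , trans Tj≡Sj Sj≡c) c-free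
  ... | inj₁ Tj≡Sj         | inj₂ Sj-leaf   = subst IsLeaf (sym Tj≡Sj) Sj-leaf

  target : Fin p → Fin n
  target i = leaf (inject₁ i)

  canonical : Configuration
  canonical = config target (inject₁-injective ∘ leaf-injective)

  AtTarget : Configuration → Fin p → Set
  AtTarget S j = pos S j ≡ target j

  placing-improves : ∀ {S U T i} → Vacated (target i) S U → Moved U i (target i) T → ¬ AtTarget S i →
                     Improves AtTarget S T
  placing-improves {S} {U} {T} {i} (vacated _ stays-or-leaves) (moved arrived fixed) misplaced =
    stays-placed , i , misplaced , arrived
    where
    stays-placed : ∀ j → AtTarget S j → AtTarget T j
    stays-placed j placed with j ≟ i | stays-or-leaves j
    ... | yes refl | _                  = arrived
    ... | no  j≢i  | inj₁ Uj≡Sj         = trans (fixed j j≢i) (trans Uj≡Sj placed)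
    ... | no  j≢i  | inj₂ (Sj≡ti , _)   =
      contradiction (inject₁-injective (leaf-injective (trans (sym placed) Sj≡ti))) j≢i

  placeRobot : ∀ S → OnLeaves S → ∀ i → ¬ AtTarget S i →
               ∃[ T ] Reach S T × OnLeaves T × Improves AtTarget S T
  placeRobot S onLeaves i misplaced
    with U , S⇝U , vac ← vacateLeaf S (inject₁ i , refl) (onLeaves⇒c-free {S} onLeaves)
    with T , U⇝T , i↦t ← hop U i (leaf∼c (vacated-onLeaves onLeaves vac i))
                               (onLeaves⇒c-free {U} (vacated-onLeaves onLeaves vac))
                               (inject₁ i) (Vacated.x-free vac) =
    T , S⇝U ◅◅ U⇝T , moved-onLeaves (vacated-onLeaves onLeaves vac) (inject₁ i , refl) i↦t ,
    placing-improves vac i↦t misplaced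

  reachCanonical : ∀ S → Reach S canonical
  reachCanonical S
    with U , S⇝U , inStar ← Gathering.gather connected inStar? (inj₁ refl) clearStar S
    with V , U⇝V , vac ← vacateCenter U
    with T , V⇝T , _ , placed ← reachAllGood (λ T j → pos T j ≟ target j) OnLeaves placeRobot V
                                              (gathered-onLeaves inStar vac) =
    S⇝U ◅◅ U⇝V ◅◅ V⇝T ◅◅ inj₂ (sym ∘ placed) ◅ ε

  universallySolvable : UniversallySolvable G p
  universallySolvable S T = reach⇒reachable (reachCanonical S ◅◅ reach-sym (reachCanonical T))

highDegree⇒universallySolvable : ∀ {n} (G : Graph n) {p} → Connected G →
                                 ∀ c → p < higherDegree G c → UniversallySolvable G p
highDegree⇒universallySolvable G connected c p<deg
  with leaf , leaf-injective , adjacent ← count⇒injection (λ v → does (c <? v) ∧ adj G c v) p<deg =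
  LargeStar.universallySolvable G connected c leaf leaf-injective λ e → ∧-conicalʳ _ _ (adjacent e)

mainTheorem11 : ∀ (n : ℕ) (G : Graph n) (p : ℕ) → Connected G → 2 ≤ p → p ≤ n →
    ¬ UniversallySolvable G p → edgeCount G < p * n
mainTheorem11 zero    G p _         (s≤s (s≤s _)) () _
mainTheorem11 (suc m) G p connected 2≤p _ unsolvable with any? (λ u → suc p ≤? higherDegree G u)
... | yes (c , p<deg) = contradiction (highDegree⇒universallySolvable G connected c p<deg) unsolvable
... | no  none-high   = edgeCount<-bound G (≤-trans (s≤s z≤n) 2≤p) λ u → ≮⇒≥ (none-high ∘ (u ,_))
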